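{- Let $v,w\in\mathbb{Q}$ with $v>1$ and $w>1$, and let $E_{v,w}$ be the elliptic curve \[ y^2 = x\left(x-(v-v^{ -1})^2\right)\left(x-(w-w^{ -1})^2\right) \] over $\mathbb{Q}$. Let $u\in\mathbb{Q}$ satisfy the condition \[ \max\left(\tfrac{v}{w},\tfrac{w}{v}\right)<u<vw , \] so that there is a (non-degenerate, bounded) hyperbolic triangle with side lengths $\log(u),\log(v),\log(w)$. Put \[ x_0=\frac{(v^2-1)(w^2-1)(uvw-1)}{vw(vw-u)} . \] Then this triangle is a hyperbolic Heron triangle if and only if there is $y_0\in\mathbb{Q}$ such that $(x_0,y_0)\in E_{v,w}(\mathbb{Q})$. Moreover $u$ is recovered from $x_0$ by \[ u=\frac{v^2w^2x_0+(v^2-1)(w^2-1)}{vw\big(x_0+(v^2-1)(w^2-1)\big)} , \] so that such Heron triangles with two sides of lengths $\log(v),\log(w)$ correspond to rational points $(x,y)$ of $E_{v,w}$ whose $x$-coordinate yields, via this formula, a $u$ satisfying $\max(v/w,w/v)<u<vw$.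
   Context: All triangles are non-degenerate bounded triangles in the hyperbolic plane (curvature $-1$). For a triangle with side lengths $a,b,c$, opposite angles $\alpha,\beta,\gamma$ and area $A=\pi-\alpha-\beta-\gamma$, it is called a hyperbolic Heron triangle if $e^a,e^b,e^c\in\mathbb{Q}$ and $e^{i\alpha},e^{i\beta},e^{i\gamma},e^{iA}\in\mathbb{Q}[i]$ (equivalently, the sine and cosine of each angle and of the area are rational). -}

module Defs where

open import Data.Rational using (ℚ; 0ℚ; 1ℚ; ½; _+_; _*_; _-_; -_; 1/_; _<_; ≢-nonZero)
open import Data.Rational.Properties using (_≟_)
open import Data.Product using (Σ; _×_)
open import Relation.Nullary using (yes; no)
open import Relation.Binary.PropositionalEquality using (_≡_)

-- Total inverse on ℚ (convention 0⁻¹ = 0); only ever applied to nonzero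
-- arguments in the statement.
inv : ℚ → ℚ
inv p with p ≟ 0ℚ
... | yes _  = 0ℚ
... | no p≢0 = 1/_ p {{≢-nonZero p≢0}}

infixl 7 _÷'_
_÷'_ : ℚ → ℚ → ℚ
p ÷' q = p * inv q

sq : ℚ → ℚ
sq x = x * x

-- For a side length a with e^a = p:  cosh a and sinh a.
ch : ℚ → ℚ
ch p = ½ * (p + inv p)

sh : ℚ → ℚ
sh p = ½ * (p - inv p)

record ℚ[i] : Set where
  constructor _+i_
  field
    re : ℚ
    im : ℚ
open ℚ[i] public

_*ᵢ_ : ℚ[i] → ℚ[i] → ℚ[i]
(a +i b) *ᵢ (c +i d) = (a * c - b * d) +i (a * d + b * c)

-- A non-degenerate bounded hyperbolic triangle with side lengths
-- a = log p, b = log q, c = log r  (so e^a = p, e^b = q, e^c = r):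
-- all sides positive and strict triangle inequalities (a < b + c etc.).
IsHypTriangle : ℚ → ℚ → ℚ → Set
IsHypTriangle p q r =
  1ℚ < p × 1ℚ < q × 1ℚ < r × p < q * r × q < p * r × r < p * q

-- z = e^{iα} where α ∈ (0,π) is the angle opposite the side of length
-- log p, in a triangle whose other sides are log q, log r.  The angle is
-- determined by the hyperbolic law of cosines
--   cos α · sinh b · sinh c = cosh b · cosh c − cosh a,
-- together with |e^{iα}| = 1 and sin α > 0.
IsExpIAngle : ℚ[i] → ℚ → ℚ → ℚ → Set
IsExpIAngle z p q r =
  sq (re z) + sq (im z) ≡ 1ℚ × 0ℚ < im z ×
  re z * (sh q * sh r) ≡ ch q * ch r - ch p

-- Hyperbolic Heron triangle with side lengths log p, log q, log r
-- (e^a, e^b, e^c ∈ ℚ is built in since p q r : ℚ):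
-- e^{iα}, e^{iβ}, e^{iγ} ∈ ℚ[i], and e^{iA} ∈ ℚ[i] where A = π − α − β − γ,
-- i.e. e^{iA} · e^{iα} e^{iβ} e^{iγ} = e^{iπ} = −1.
HyperbolicHeron : ℚ → ℚ → ℚ → Set
HyperbolicHeron p q r =
  IsHypTriangle p q r ×
  Σ ℚ[i] λ zα → Σ ℚ[i] λ zβ → Σ ℚ[i] λ zγ → Σ ℚ[i] λ zA →
    IsExpIAngle zα p q r × IsExpIAngle zβ q r p × IsExpIAngle zγ r p q ×
    zA *ᵢ (zα *ᵢ (zβ *ᵢ zγ)) ≡ (- 1ℚ) +i 0ℚ

OnE : ℚ → ℚ → ℚ → ℚ → Set
OnE v w x y = sq y ≡ x * (x - sq (v - inv v)) * (x - sq (w - inv w))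

-- Put Δ = gramDet (ch u) (ch v) (ch w).  By the hyperbolic law of cosines the
-- angle α opposite log u satisfies cos α · sh v · sh w = ch v · ch w − ch u, and
-- then (sin α · sh v · sh w)² = Δ.  Since Δ is symmetric in the three sides and
-- all ch, sh are rational, the three angles have rational cosine and sine iff Δ
-- is a rational square, and e^{iA} = −conj (e^{iα} e^{iβ} e^{iγ}) comes for free.
-- Clearing denominators gives (uvw)² Δ = ¼ (uvw − 1)(vw − u)(uw − v)(uv − w),
-- which is positive on triangles, and the cubic of E_{v,w} at x₀ is Δ times a
-- nonzero rational square, so Δ is a square iff x₀ is the abscissa of a rational
-- point.  Solving the Möbius relation x₀ = f(u) for u gives the formula for u.
{-# OPTIONS --safe #-}
module Submission where

open import Defs
open import Data.Rational using (ℚ; 0ℚ; 1ℚ; ½; _+_; _*_; _-_; -_; _<_; _⊔_; positive)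
open import Data.Rational.Properties
  using ( _≟_; +-*-commutativeRing; *-inverseʳ; *-identityˡ; *-identityʳ; *-zeroʳ; *-comm
        ; +-inverseʳ; <-cmp; <⇒≢; <-trans; ≤-<-trans; p≤p⊔q; p≤q⊔p
        ; positive⁻¹; pos*pos⇒pos; pos+pos⇒pos; 1/pos⇒pos; +-monoˡ-<; +-mono-<
        ; *-monoˡ-<-pos; *-cancelʳ-<-nonNeg; *-cancelˡ-<-nonNeg; neg-antimono-<; pos⇒nonNeg )
open import Data.Product using (Σ; _×_; _,_; proj₁)
open import Function.Bundles using (_⇔_; mk⇔)
open import Function.Nary.NonDependent using (congₙ)
open import Function.Properties.Equivalence using () renaming (trans to ⇔-trans; sym to ⇔-sym)
open import Level using (0ℓ)
open import Relation.Binary.Definitions using (tri<; tri≈; tri>)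
open import Relation.Binary.PropositionalEquality
open import Relation.Nullary using (yes; no; contradiction)
open import Relation.Nullary.Decidable.Core using (dec⇒maybe)
open import Tactic.RingSolver using (solve-∀)
open import Tactic.RingSolver.Core.AlmostCommutativeRing using (AlmostCommutativeRing; fromCommutativeRing)

open ≡-Reasoning

ℚ-ring : AlmostCommutativeRing 0ℓ 0ℓ
ℚ-ring = fromCommutativeRing +-*-commutativeRing (λ x → dec⇒maybe (0ℚ ≟ x))

private
  variable
    p q r s : ℚ
    z : ℚ[i]

*-invʳ : p ≢ 0ℚ → p * inv p ≡ 1ℚ
*-invʳ {p} p≢0 with p ≟ 0ℚ
... | yes p≡0 = contradiction p≡0 p≢0
... | no  _   = *-inverseʳ p {{_}}

p÷'q*q≡p : ∀ p → q ≢ 0ℚ → (p ÷' q) * q ≡ p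
p÷'q*q≡p {q} p q≢0 = begin
  p * inv q * q    ≡⟨ reassoc p q (inv q) ⟩
  p * (q * inv q)  ≡⟨ cong (p *_) (*-invʳ q≢0) ⟩
  p * 1ℚ           ≡⟨ *-identityʳ p ⟩
  p                ∎
  where
  reassoc : ∀ p q i → p * i * q ≡ p * (q * i)
  reassoc = solve-∀ ℚ-ring

inv-*-cancelˡ : r ≢ 0ℚ → inv r * (r * p) ≡ p
inv-*-cancelˡ {r} {p} r≢0 = begin
  inv r * (r * p)  ≡⟨ reassoc r (inv r) p ⟩
  r * inv r * p    ≡⟨ cong (_* p) (*-invʳ r≢0) ⟩
  1ℚ * p           ≡⟨ *-identityˡ p ⟩
  p                ∎
  where
  reassoc : ∀ r i p → i * (r * p) ≡ r * i * p
  reassoc = solve-∀ ℚ-ring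

*-cancelˡ-≡ : r ≢ 0ℚ → r * p ≡ r * q → p ≡ q
*-cancelˡ-≡ {r} r≢0 eq = trans (sym (inv-*-cancelˡ r≢0)) (trans (cong (inv r *_) eq) (inv-*-cancelˡ r≢0))

p*q≡r⇒p≡r÷'q : q ≢ 0ℚ → p * q ≡ r → p ≡ r ÷' q
p*q≡r⇒p≡r÷'q {q} {p} {r} q≢0 pq≡r = *-cancelˡ-≡ q≢0 (begin
  q * p           ≡⟨ *-comm q p ⟩
  p * q           ≡⟨ pq≡r ⟩
  r               ≡⟨ p÷'q*q≡p r q≢0 ⟨
  r ÷' q * q      ≡⟨ *-comm (r ÷' q) q ⟩
  q * (r ÷' q)    ∎)

sq≢0 : p ≢ 0ℚ → sq p ≢ 0ℚ
sq≢0 {p} p≢0 pp≡0 = p≢0 (*-cancelˡ-≡ p≢0 (trans pp≡0 (sym (*-zeroʳ p))))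

pos⇒≢0 : 0ℚ < p → p ≢ 0ℚ
pos⇒≢0 0<p = ≢-sym (<⇒≢ 0<p)

*-pos : 0ℚ < p → 0ℚ < q → 0ℚ < p * q
*-pos {p} {q} 0<p 0<q = positive⁻¹ _ {{pos*pos⇒pos p {{positive 0<p}} q {{positive 0<q}}}}

+-pos : 0ℚ < p → 0ℚ < q → 0ℚ < p + q
+-pos {p} {q} 0<p 0<q = positive⁻¹ _ {{pos+pos⇒pos p {{positive 0<p}} q {{positive 0<q}}}}

inv-pos : 0ℚ < p → 0ℚ < inv p
inv-pos {p} 0<p with p ≟ 0ℚ
... | yes p≡0 = contradiction p≡0 (pos⇒≢0 0<p)
... | no  p≢0 = positive⁻¹ _ {{1/pos⇒pos p {{positive 0<p}}}}

p<q⇒0<q-p : p < q → 0ℚ < q - p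
p<q⇒0<q-p {p} {q} p<q = subst (_< q - p) (+-inverseʳ p) (+-monoˡ-< (- p) p<q)

0<p*q⇒0<q : 0ℚ < p → 0ℚ < p * q → 0ℚ < q
0<p*q⇒0<q {p} {q} 0<p 0<pq =
  *-cancelˡ-<-nonNeg p {{pos⇒nonNeg p {{positive 0<p}}}} (subst (_< p * q) (sym (*-zeroʳ p)) 0<pq)

1<p⇒0<p : 1ℚ < p → 0ℚ < p
1<p⇒0<p = <-trans (positive⁻¹ 1ℚ)

1<p⇒p≢0 : 1ℚ < p → p ≢ 0ℚ
1<p⇒p≢0 1<p = pos⇒≢0 (1<p⇒0<p 1<p)

1<p*q : 1ℚ < p → 1ℚ < q → 1ℚ < p * q
1<p*q {p} {q} 1<p 1<q =
  <-trans 1<q (subst (_< p * q) (*-identityˡ q) (*-monoˡ-<-pos q {{positive (1<p⇒0<p 1<q)}} 1<p))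

1<p⇒0<p²-1 : 1ℚ < p → 0ℚ < sq p - 1ℚ
1<p⇒0<p²-1 1<p = p<q⇒0<q-p (1<p*q 1<p 1<p)

p÷'q<r⇒p<r*q : 0ℚ < q → p ÷' q < r → p < r * q
p÷'q<r⇒p<r*q {q} {p} 0<q p÷'q<r =
  subst (_< _) (p÷'q*q≡p p (pos⇒≢0 0<q)) (*-monoˡ-<-pos q {{positive 0<q}} p÷'q<r)

IsSquare : ℚ → Set
IsSquare p = Σ ℚ λ s → sq s ≡ p

positive-root : 0ℚ < p → IsSquare p → Σ ℚ λ s → 0ℚ < s × sq s ≡ p
positive-root {p} 0<p (s , s²≡p) with <-cmp 0ℚ s
... | tri< 0<s _ _ = s , 0<s , s²≡p
... | tri≈ _ 0≡s _ = contradiction (trans (sym s²≡p) (cong sq (sym 0≡s))) (pos⇒≢0 0<p)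
... | tri> _ _ s<0 = - s , neg-antimono-< s<0 , trans (neg-square s) s²≡p
  where
  neg-square : ∀ s → (- s) * (- s) ≡ s * s
  neg-square = solve-∀ ℚ-ring

IsSquare-transfer : ∀ {r d k g} → g ≢ 0ℚ → r * sq k ≡ d * sq g → IsSquare r → IsSquare d
IsSquare-transfer {r} {d} {k} {g} g≢0 eq (y , y²≡r) = y * k ÷' g , *-cancelˡ-≡ (sq≢0 g≢0) (begin
  sq g * sq (y * k ÷' g)    ≡⟨ commute (sq g) _ ⟩
  sq (y * k ÷' g) * sq g    ≡⟨ square-product (y * k ÷' g) g ⟩
  sq (y * k ÷' g * g)       ≡⟨ cong sq (p÷'q*q≡p (y * k) g≢0) ⟩
  sq (y * k)                ≡⟨ square-product y k ⟨
  sq y * sq k               ≡⟨ cong (_* sq k) y²≡r ⟩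
  r * sq k                  ≡⟨ eq ⟩
  d * sq g                  ≡⟨ commute d (sq g) ⟩
  sq g * d                  ∎)
  where
  square-product : ∀ a b → a * a * (b * b) ≡ (a * b) * (a * b)
  square-product = solve-∀ ℚ-ring
  commute : ∀ a b → a * b ≡ b * a
  commute = solve-∀ ℚ-ring

SameSquareClass : ℚ → ℚ → Set
SameSquareClass r d = Σ ℚ λ k → Σ ℚ λ g → k ≢ 0ℚ × g ≢ 0ℚ × r * sq k ≡ d * sq g

SameSquareClass⇒IsSquare⇔ : SameSquareClass p q → IsSquare p ⇔ IsSquare q
SameSquareClass⇒IsSquare⇔ (k , g , k≢0 , g≢0 , eq) =
  mk⇔ (IsSquare-transfer {k = k} g≢0 eq) (IsSquare-transfer {k = g} k≢0 (sym eq))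

p*ch-p : p ≢ 0ℚ → p * ch p ≡ ½ * (p * p + 1ℚ)
p*ch-p {p} p≢0 = trans (expand p (inv p)) (cong (λ t → ½ * (p * p + t)) (*-invʳ p≢0))
  where
  expand : ∀ p i → p * (½ * (p + i)) ≡ ½ * (p * p + p * i)
  expand = solve-∀ ℚ-ring

p*sh-p : p ≢ 0ℚ → p * sh p ≡ ½ * (p * p - 1ℚ)
p*sh-p {p} p≢0 = trans (expand p (inv p)) (cong (λ t → ½ * (p * p - t)) (*-invʳ p≢0))
  where
  expand : ∀ p i → p * (½ * (p - i)) ≡ ½ * (p * p - p * i)
  expand = solve-∀ ℚ-ring

sh²≡ch²-1 : p ≢ 0ℚ → sq (sh p) ≡ sq (ch p) - 1ℚ
sh²≡ch²-1 {p} p≢0 = trans (expand p (inv p)) (cong (λ t → sq (ch p) - t) (*-invʳ p≢0))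
  where
  expand : ∀ p i → ½ * (p - i) * (½ * (p - i)) ≡ ½ * (p + i) * (½ * (p + i)) - p * i
  expand = solve-∀ ℚ-ring

sh-pos : 1ℚ < p → 0ℚ < sh p
sh-pos 1<p = 0<p*q⇒0<q (1<p⇒0<p 1<p) (subst (0ℚ <_) (sym (p*sh-p (1<p⇒p≢0 1<p)))
  (*-pos (positive⁻¹ ½) (1<p⇒0<p²-1 1<p)))

[p-p⁻¹]²*p² : p ≢ 0ℚ → sq (p - inv p) * sq p ≡ sq (sq p - 1ℚ)
[p-p⁻¹]²*p² {p} p≢0 = trans (expand p (inv p)) (cong (λ t → sq (sq p - t)) (*-invʳ p≢0))
  where
  expand : ∀ p i → (p - i) * (p - i) * (p * p) ≡ (p * p - p * i) * (p * p - p * i)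
  expand = solve-∀ ℚ-ring

-- det [[1 , c , b] , [c , 1 , a] , [b , a , 1]]
gramDet : ℚ → ℚ → ℚ → ℚ
gramDet a b c = 1ℚ - a * a - b * b - c * c + (1ℚ + 1ℚ) * a * b * c

gramDet-rotate : ∀ a b c → gramDet a b c ≡ gramDet b c a
gramDet-rotate = rotate
  where
  rotate : ∀ a b c → 1ℚ - a * a - b * b - c * c + (1ℚ + 1ℚ) * a * b * c
                   ≡ 1ℚ - b * b - c * c - a * a + (1ℚ + 1ℚ) * b * c * a
  rotate = solve-∀ ℚ-ring

gramDet≡[b²-1][c²-1]-[bc-a]² : ∀ a b c → gramDet a b c ≡ (b * b - 1ℚ) * (c * c - 1ℚ) - (b * c - a) * (b * c - a)
gramDet≡[b²-1][c²-1]-[bc-a]² = expand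
  where
  expand : ∀ a b c → 1ℚ - a * a - b * b - c * c + (1ℚ + 1ℚ) * a * b * c
                   ≡ (b * b - 1ℚ) * (c * c - 1ℚ) - (b * c - a) * (b * c - a)
  expand = solve-∀ ℚ-ring

heronProduct : ℚ → ℚ → ℚ → ℚ
heronProduct p q r = (p * q * r - 1ℚ) * (q * r - p) * (p * r - q) * (p * q - r)

gramDet-ch : p ≢ 0ℚ → q ≢ 0ℚ → r ≢ 0ℚ →
  sq (p * q * r) * gramDet (ch p) (ch q) (ch r) ≡ ½ * ½ * heronProduct p q r
gramDet-ch {p} {q} {r} p≢0 q≢0 r≢0 = begin
  sq (p * q * r) * gramDet (ch p) (ch q) (ch r)
    ≡⟨ homogenise p q r (ch p) (ch q) (ch r) ⟩
  H (p * ch p) (q * ch q) (r * ch r)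
    ≡⟨ congₙ 3 H (p*ch-p p≢0) (p*ch-p q≢0) (p*ch-p r≢0) ⟩
  H (½ * (p * p + 1ℚ)) (½ * (q * q + 1ℚ)) (½ * (r * r + 1ℚ))
    ≡⟨ factorise p q r ⟩
  ½ * ½ * heronProduct p q r ∎
  where
  H : ℚ → ℚ → ℚ → ℚ
  H a b c = sq (p * q * r) - sq (q * r) * sq a - sq (p * r) * sq b - sq (p * q) * sq c
            + (1ℚ + 1ℚ) * a * b * c * (p * q * r)
  homogenise : ∀ p q r a b c →
    (p * q * r) * (p * q * r) * (1ℚ - a * a - b * b - c * c + (1ℚ + 1ℚ) * a * b * c)
    ≡ (p * q * r) * (p * q * r) - (q * r) * (q * r) * ((p * a) * (p * a))
      - (p * r) * (p * r) * ((q * b) * (q * b)) - (p * q) * (p * q) * ((r * c) * (r * c))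
      + (1ℚ + 1ℚ) * (p * a) * (q * b) * (r * c) * (p * q * r)
  homogenise = solve-∀ ℚ-ring
  factorise : ∀ p q r →
    (p * q * r) * (p * q * r) - (q * r) * (q * r) * ((½ * (p * p + 1ℚ)) * (½ * (p * p + 1ℚ)))
      - (p * r) * (p * r) * ((½ * (q * q + 1ℚ)) * (½ * (q * q + 1ℚ)))
      - (p * q) * (p * q) * ((½ * (r * r + 1ℚ)) * (½ * (r * r + 1ℚ)))
      + (1ℚ + 1ℚ) * (½ * (p * p + 1ℚ)) * (½ * (q * q + 1ℚ)) * (½ * (r * r + 1ℚ)) * (p * q * r)
    ≡ ½ * ½ * ((p * q * r - 1ℚ) * (q * r - p) * (p * r - q) * (p * q - r))
  factorise = solve-∀ ℚ-ring

triangle⇒0<heronProduct : IsHypTriangle p q r → 0ℚ < heronProduct p q r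
triangle⇒0<heronProduct (1<p , 1<q , 1<r , p<qr , q<pr , r<pq) =
  *-pos (*-pos (*-pos (p<q⇒0<q-p (1<p*q (1<p*q 1<p 1<q) 1<r)) (p<q⇒0<q-p p<qr)) (p<q⇒0<q-p q<pr))
        (p<q⇒0<q-p r<pq)

triangle⇒0<gramDet : IsHypTriangle p q r → 0ℚ < gramDet (ch p) (ch q) (ch r)
triangle⇒0<gramDet t@(1<p , 1<q , 1<r , _) =
  0<p*q⇒0<q (*-pos 0<pqr 0<pqr)
    (subst (0ℚ <_) (sym (gramDet-ch (1<p⇒p≢0 1<p) (1<p⇒p≢0 1<q) (1<p⇒p≢0 1<r)))
      (*-pos (*-pos (positive⁻¹ ½) (positive⁻¹ ½)) (triangle⇒0<heronProduct t)))
  where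
  0<pqr = 1<p⇒0<p (1<p*q (1<p*q 1<p 1<q) 1<r)

sq[sh-p*sh-q] : p ≢ 0ℚ → q ≢ 0ℚ → sq (sh p * sh q) ≡ (sq (ch p) - 1ℚ) * (sq (ch q) - 1ℚ)
sq[sh-p*sh-q] {p} {q} p≢0 q≢0 =
  trans (square-product (sh p) (sh q)) (cong₂ _*_ (sh²≡ch²-1 p≢0) (sh²≡ch²-1 q≢0))
  where
  square-product : ∀ a b → (a * b) * (a * b) ≡ a * a * (b * b)
  square-product = solve-∀ ℚ-ring

angle⇒IsSquare-gramDet : q ≢ 0ℚ → r ≢ 0ℚ → IsExpIAngle z p q r → IsSquare (gramDet (ch p) (ch q) (ch r))
angle⇒IsSquare-gramDet {q = q} {r = r} {z = z} {p = p} q≢0 r≢0 (norm≡1 , _ , cos-law) = im z * m , (begin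
  sq (im z * m)
    ≡⟨ unit-circle (re z) (im z) m ⟩
  (sq (re z) + sq (im z)) * sq m - sq (re z * m)
    ≡⟨ congₙ 3 (λ n k l → n * k - sq l) norm≡1 (sq[sh-p*sh-q] q≢0 r≢0) cos-law ⟩
  1ℚ * ((sq (ch q) - 1ℚ) * (sq (ch r) - 1ℚ)) - sq N
    ≡⟨ cong (_- sq N) (*-identityˡ ((sq (ch q) - 1ℚ) * (sq (ch r) - 1ℚ))) ⟩
  (sq (ch q) - 1ℚ) * (sq (ch r) - 1ℚ) - sq N
    ≡⟨ gramDet≡[b²-1][c²-1]-[bc-a]² (ch p) (ch q) (ch r) ⟨
  gramDet (ch p) (ch q) (ch r) ∎)
  where
  m = sh q * sh r
  N = ch q * ch r - ch p
  unit-circle : ∀ c s m → (s * m) * (s * m) ≡ (c * c + s * s) * (m * m) - (c * m) * (c * m)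
  unit-circle = solve-∀ ℚ-ring

root⇒angle : 1ℚ < q → 1ℚ < r → 0ℚ < s → sq s ≡ gramDet (ch p) (ch q) (ch r) →
  Σ ℚ[i] λ z → IsExpIAngle z p q r
root⇒angle {q} {r} {s} {p} 1<q 1<r 0<s s²≡Δ =
  ((N ÷' m) +i (s ÷' m)) , norm≡1 , *-pos 0<s (inv-pos 0<m) , p÷'q*q≡p N m≢0
  where
  m = sh q * sh r
  N = ch q * ch r - ch p
  0<m = *-pos (sh-pos 1<q) (sh-pos 1<r)
  m≢0 = pos⇒≢0 0<m
  norm≡1 : sq (N ÷' m) + sq (s ÷' m) ≡ 1ℚ
  norm≡1 = *-cancelˡ-≡ (sq≢0 m≢0) (begin
    sq m * (sq (N ÷' m) + sq (s ÷' m))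
      ≡⟨ distribute m (N ÷' m) (s ÷' m) ⟩
    sq (N ÷' m * m) + sq (s ÷' m * m)
      ≡⟨ cong₂ (λ a b → sq a + sq b) (p÷'q*q≡p N m≢0) (p÷'q*q≡p s m≢0) ⟩
    sq N + sq s
      ≡⟨ cong (sq N +_) (trans s²≡Δ (gramDet≡[b²-1][c²-1]-[bc-a]² (ch p) (ch q) (ch r))) ⟩
    sq N + ((sq (ch q) - 1ℚ) * (sq (ch r) - 1ℚ) - sq N)
      ≡⟨ add-sub (sq N) _ ⟩
    (sq (ch q) - 1ℚ) * (sq (ch r) - 1ℚ)
      ≡⟨ sq[sh-p*sh-q] (1<p⇒p≢0 1<q) (1<p⇒p≢0 1<r) ⟨
    sq m
      ≡⟨ *-identityʳ (sq m) ⟨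
    sq m * 1ℚ ∎)
    where
    distribute : ∀ m a b → m * m * (a * a + b * b) ≡ (a * m) * (a * m) + (b * m) * (b * m)
    distribute = solve-∀ ℚ-ring
    add-sub : ∀ a b → a + (b - a) ≡ b
    add-sub = solve-∀ ℚ-ring

norm : ℚ[i] → ℚ
norm z = sq (re z) + sq (im z)

norm-*ᵢ : ∀ z w → norm (z *ᵢ w) ≡ norm z * norm w
norm-*ᵢ (a +i b) (c +i d) = brahmagupta a b c d
  where
  brahmagupta : ∀ a b c d → (a * c - b * d) * (a * c - b * d) + (a * d + b * c) * (a * d + b * c)
                          ≡ (a * a + b * b) * (c * c + d * d)
  brahmagupta = solve-∀ ℚ-ring

norm≡1-*ᵢ : ∀ {z w} → norm z ≡ 1ℚ → norm w ≡ 1ℚ → norm (z *ᵢ w) ≡ 1ℚ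
norm≡1-*ᵢ {z} {w} ∣z∣≡1 ∣w∣≡1 = trans (norm-*ᵢ z w) (trans (cong₂ _*_ ∣z∣≡1 ∣w∣≡1) (*-identityˡ 1ℚ))

norm≡1⇒∃[w]w*ᵢz≡-1 : norm z ≡ 1ℚ → Σ ℚ[i] λ w → w *ᵢ z ≡ (- 1ℚ) +i 0ℚ
norm≡1⇒∃[w]w*ᵢz≡-1 {a +i b} ∣z∣≡1 = ((- a) +i b) , cong₂ _+i_ (trans (real-part a b) (cong -_ ∣z∣≡1)) (imaginary-part a b)
  where
  real-part : ∀ a b → (- a) * a - b * b ≡ - (a * a + b * b)
  real-part = solve-∀ ℚ-ring
  imaginary-part : ∀ a b → (- a) * b + b * a ≡ 0ℚ
  imaginary-part = solve-∀ ℚ-ring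

angles⇒heron : IsHypTriangle p q r →
  Σ ℚ[i] (λ z → IsExpIAngle z p q r) → Σ ℚ[i] (λ z → IsExpIAngle z q r p) → Σ ℚ[i] (λ z → IsExpIAngle z r p q) →
  HyperbolicHeron p q r
angles⇒heron t (zα , α) (zβ , β) (zγ , γ) =
  let (zA , angle-sum) = norm≡1⇒∃[w]w*ᵢz≡-1 {z = zα *ᵢ (zβ *ᵢ zγ)}
                           (norm≡1-*ᵢ {zα} (proj₁ α) (norm≡1-*ᵢ {zβ} {zγ} (proj₁ β) (proj₁ γ)))
  in t , zα , zβ , zγ , zA , α , β , γ , angle-sum

heron⇔IsSquare-gramDet : IsHypTriangle p q r → HyperbolicHeron p q r ⇔ IsSquare (gramDet (ch p) (ch q) (ch r))
heron⇔IsSquare-gramDet {p} {q} {r} t@(1<p , 1<q , 1<r , _) = mk⇔ to from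
  where
  to : HyperbolicHeron p q r → IsSquare (gramDet (ch p) (ch q) (ch r))
  to (_ , zα , _ , _ , _ , α , _) = angle⇒IsSquare-gramDet {z = zα} {p = p} (1<p⇒p≢0 1<q) (1<p⇒p≢0 1<r) α
  from : IsSquare (gramDet (ch p) (ch q) (ch r)) → HyperbolicHeron p q r
  from □ =
    let (s , 0<s , s²≡Δα) = positive-root (triangle⇒0<gramDet t) □
        s²≡Δβ = trans s²≡Δα (gramDet-rotate (ch p) (ch q) (ch r))
        s²≡Δγ = trans s²≡Δβ (gramDet-rotate (ch q) (ch r) (ch p))
    in angles⇒heron t (root⇒angle {p = p} 1<q 1<r 0<s s²≡Δα)
                      (root⇒angle {p = q} 1<r 1<p 0<s s²≡Δβ)
                      (root⇒angle {p = r} 1<p 1<q 0<s s²≡Δγ)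

cubicE : ℚ → ℚ → ℚ → ℚ
cubicE v w x = x * (x - sq (v - inv v)) * (x - sq (w - inv w))

cubicE-cleared : ∀ {v w} → v ≢ 0ℚ → w ≢ 0ℚ → ∀ x t →
  cubicE v w x * sq (v * w * sq t)
  ≡ t * ((x * t) * (sq v * (x * t) - sq (sq v - 1ℚ) * t) * (sq w * (x * t) - sq (sq w - 1ℚ) * t))
cubicE-cleared {v} {w} v≢0 w≢0 x t = begin
  cubicE v w x * sq (v * w * sq t)
    ≡⟨ homogenise x t v w (sq (v - inv v)) (sq (w - inv w)) ⟩
  t * ((x * t) * (sq v * (x * t) - sq (v - inv v) * sq v * t) * (sq w * (x * t) - sq (w - inv w) * sq w * t))
    ≡⟨ cong₂ (λ a b → t * ((x * t) * (sq v * (x * t) - a * t) * (sq w * (x * t) - b * t)))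
             ([p-p⁻¹]²*p² v≢0) ([p-p⁻¹]²*p² w≢0) ⟩
  t * ((x * t) * (sq v * (x * t) - sq (sq v - 1ℚ) * t) * (sq w * (x * t) - sq (sq w - 1ℚ) * t)) ∎
  where
  homogenise : ∀ x t v w A B →
    x * (x - A) * (x - B) * ((v * w * (t * t)) * (v * w * (t * t)))
    ≡ t * ((x * t) * (v * v * (x * t) - A * (v * v) * t) * (w * w * (x * t) - B * (w * w) * t))
  homogenise = solve-∀ ℚ-ring

x₀ : ℚ → ℚ → ℚ → ℚ
x₀ u v w = (sq v - 1ℚ) * (sq w - 1ℚ) * (u * v * w - 1ℚ) ÷' (v * w * (v * w - u))

cubicE-x₀-cleared : ∀ {u v w} → u ≢ 0ℚ → v ≢ 0ℚ → w ≢ 0ℚ → v * w * (v * w - u) ≢ 0ℚ →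
  cubicE v w (x₀ u v w) * sq (v * w * sq (v * w * (v * w - u)))
  ≡ gramDet (ch u) (ch v) (ch w)
    * sq ((1ℚ + 1ℚ) * (u * v * w) * (v * w * (sq v - 1ℚ) * (sq w - 1ℚ) * (sq v * sq w - 1ℚ)))
cubicE-x₀-cleared {u} {v} {w} u≢0 v≢0 w≢0 T≢0 = begin
  cubicE v w (x₀ u v w) * sq (v * w * sq T)
    ≡⟨ cubicE-cleared v≢0 w≢0 (x₀ u v w) T ⟩
  T * ((x₀ u v w * T) * (sq v * (x₀ u v w * T) - sq v²-1 * T) * (sq w * (x₀ u v w * T) - sq w²-1 * T))
    ≡⟨ cong (λ y → T * (y * (sq v * y - sq v²-1 * T) * (sq w * y - sq w²-1 * T))) (p÷'q*q≡p X T≢0) ⟩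
  T * (X * (sq v * X - sq v²-1 * T) * (sq w * X - sq w²-1 * T))
    ≡⟨ factorise u v w ⟩
  ½ * ½ * heronProduct u v w * sq ((1ℚ + 1ℚ) * h)
    ≡⟨ cong (_* sq ((1ℚ + 1ℚ) * h)) (gramDet-ch u≢0 v≢0 w≢0) ⟨
  sq (u * v * w) * gramDet (ch u) (ch v) (ch w) * sq ((1ℚ + 1ℚ) * h)
    ≡⟨ regroup (u * v * w) (gramDet (ch u) (ch v) (ch w)) h ⟩
  gramDet (ch u) (ch v) (ch w) * sq ((1ℚ + 1ℚ) * (u * v * w) * h) ∎
  where
  v²-1 = sq v - 1ℚ
  w²-1 = sq w - 1ℚ
  T = v * w * (v * w - u)
  X = v²-1 * w²-1 * (u * v * w - 1ℚ)
  h = v * w * v²-1 * w²-1 * (sq v * sq w - 1ℚ)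
  -- v² X - (v² - 1)² T = v (v² - 1) (u w - v) (v² w² - 1), and symmetrically in w
  factorise : ∀ u v w →
    let p = v * v - 1ℚ
        q = w * w - 1ℚ
        T = v * w * (v * w - u)
        X = p * q * (u * v * w - 1ℚ)
        h = v * w * p * q * (v * v * (w * w) - 1ℚ)
    in T * (X * (v * v * X - p * p * T) * (w * w * X - q * q * T))
       ≡ ½ * ½ * ((u * v * w - 1ℚ) * (v * w - u) * (u * w - v) * (u * v - w)) * (((1ℚ + 1ℚ) * h) * ((1ℚ + 1ℚ) * h))
  factorise = solve-∀ ℚ-ring
  regroup : ∀ s d h → s * s * d * (((1ℚ + 1ℚ) * h) * ((1ℚ + 1ℚ) * h))
                    ≡ d * (((1ℚ + 1ℚ) * s * h) * ((1ℚ + 1ℚ) * s * h))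
  regroup = solve-∀ ℚ-ring

cubicE-x₀-SameSquareClass-gramDet : ∀ {u v w} → IsHypTriangle u v w →
  SameSquareClass (cubicE v w (x₀ u v w)) (gramDet (ch u) (ch v) (ch w))
cubicE-x₀-SameSquareClass-gramDet (1<u , 1<v , 1<w , u<vw , _) =
  _ , _ , pos⇒≢0 (*-pos 0<vw (*-pos 0<T 0<T)) , pos⇒≢0 0<g ,
  cubicE-x₀-cleared (1<p⇒p≢0 1<u) (1<p⇒p≢0 1<v) (1<p⇒p≢0 1<w) (pos⇒≢0 0<T)
  where
  0<vw = *-pos (1<p⇒0<p 1<v) (1<p⇒0<p 1<w)
  0<T = *-pos 0<vw (p<q⇒0<q-p u<vw)
  0<g = *-pos (*-pos (+-pos (positive⁻¹ 1ℚ) (positive⁻¹ 1ℚ)) (1<p⇒0<p (1<p*q (1<p*q 1<u 1<v) 1<w)))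
              (*-pos (*-pos (*-pos 0<vw (1<p⇒0<p²-1 1<v)) (1<p⇒0<p²-1 1<w))
                     (p<q⇒0<q-p (1<p*q (1<p*q 1<v 1<v) (1<p*q 1<w 1<w))))

x₀-pos : ∀ {u v w} → IsHypTriangle u v w → 0ℚ < x₀ u v w
x₀-pos (1<u , 1<v , 1<w , u<vw , _) =
  *-pos (*-pos (*-pos (1<p⇒0<p²-1 1<v) (1<p⇒0<p²-1 1<w)) (p<q⇒0<q-p (1<p*q (1<p*q 1<u 1<v) 1<w)))
        (inv-pos (*-pos (*-pos (1<p⇒0<p 1<v) (1<p⇒0<p 1<w)) (p<q⇒0<q-p u<vw)))

x₀-inverse-cleared : ∀ {u v w x} →
  x * (v * w * (v * w - u)) ≡ (sq v - 1ℚ) * (sq w - 1ℚ) * (u * v * w - 1ℚ) →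
  u * (v * w * (x + (sq v - 1ℚ) * (sq w - 1ℚ))) ≡ sq v * sq w * x + (sq v - 1ℚ) * (sq w - 1ℚ)
x₀-inverse-cleared {u} {v} {w} {x} xT≡X = begin
  u * (v * w * (x + P))      ≡⟨ rearrange u v w x P ⟩
  N + (P * a - x * T)        ≡⟨ cong (λ y → N + (P * a - y)) xT≡X ⟩
  N + (P * a - P * a)        ≡⟨ add-cancel N (P * a) ⟩
  N                          ∎
  where
  P = (sq v - 1ℚ) * (sq w - 1ℚ)
  T = v * w * (v * w - u)
  a = u * v * w - 1ℚ
  N = sq v * sq w * x + P
  rearrange : ∀ u v w x P →
    u * (v * w * (x + P)) ≡ v * v * (w * w) * x + P + (P * (u * v * w - 1ℚ) - x * (v * w * (v * w - u)))
  rearrange = solve-∀ ℚ-ring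
  add-cancel : ∀ a b → a + (b - b) ≡ a
  add-cancel = solve-∀ ℚ-ring

x₀-inverse : ∀ {u v w} → IsHypTriangle u v w →
  u ≡ (sq v * sq w * x₀ u v w + (sq v - 1ℚ) * (sq w - 1ℚ)) ÷' (v * w * (x₀ u v w + (sq v - 1ℚ) * (sq w - 1ℚ)))
x₀-inverse {u} {v} {w} t@(1<u , 1<v , 1<w , u<vw , _) =
  p*q≡r⇒p≡r÷'q (pos⇒≢0 (*-pos 0<vw (+-pos (x₀-pos t) (*-pos (1<p⇒0<p²-1 1<v) (1<p⇒0<p²-1 1<w)))))
    (x₀-inverse-cleared {u} {v} {w} (p÷'q*q≡p _ (pos⇒≢0 (*-pos 0<vw (p<q⇒0<q-p u<vw)))))
  where
  0<vw = *-pos (1<p⇒0<p 1<v) (1<p⇒0<p 1<w)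

ratio-bounds⇒triangle : ∀ {u v w} → 1ℚ < v → 1ℚ < w → (v ÷' w) ⊔ (w ÷' v) < u → u < v * w →
  IsHypTriangle u v w
ratio-bounds⇒triangle {u} {v} {w} 1<v 1<w max<u u<vw = 1<u , 1<v , 1<w , u<vw , v<uw , w<uv
  where
  0<v+w = +-pos (1<p⇒0<p 1<v) (1<p⇒0<p 1<w)
  v<uw = p÷'q<r⇒p<r*q (1<p⇒0<p 1<w) (≤-<-trans (p≤p⊔q (v ÷' w) (w ÷' v)) max<u)
  w<uv = p÷'q<r⇒p<r*q (1<p⇒0<p 1<v) (≤-<-trans (p≤q⊔p (v ÷' w) (w ÷' v)) max<u)
  1<u = *-cancelʳ-<-nonNeg (v + w) {{pos⇒nonNeg (v + w) {{positive 0<v+w}}}}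
          (subst₂ _<_ (sym (*-identityˡ (v + w))) (distribute u v w) (+-mono-< v<uw w<uv))
    where
    distribute : ∀ u v w → u * w + u * v ≡ u * (v + w)
    distribute = solve-∀ ℚ-ring

theorem2 : (u v w : ℚ) → 1ℚ < v → 1ℚ < w →
    (v ÷' w) ⊔ (w ÷' v) < u → u < v * w →
    let x0 = ((sq v - 1ℚ) * (sq w - 1ℚ) * (u * v * w - 1ℚ)) ÷' (v * w * (v * w - u))
    in (HyperbolicHeron u v w ⇔ Σ ℚ (λ y0 → OnE v w x0 y0)) ×
       u ≡ (sq v * sq w * x0 + (sq v - 1ℚ) * (sq w - 1ℚ)) ÷' (v * w * (x0 + (sq v - 1ℚ) * (sq w - 1ℚ)))
theorem2 u v w 1<v 1<w max<u u<vw =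
  ⇔-trans (heron⇔IsSquare-gramDet triangle)
          (⇔-sym (SameSquareClass⇒IsSquare⇔ (cubicE-x₀-SameSquareClass-gramDet triangle))) ,
  x₀-inverse triangle
  where
  triangle = ratio-bounds⇒triangle 1<v 1<w max<u u<vw
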